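{- Let $q$ be an odd prime power, let $(a,b)\in V(\mathbb{F}_q)$ and $\lambda=\lambda(a,b)$. Then for every $\lambda'\in\Lambda_\lambda$ there exists $(c,d)\in V(\mathbb{F}_{q^2})$ with $\lambda(c,d)=\lambda'$ such that $(a,b)$ and $(c,d)$ lie in the same connected component (of the underlying undirected graph) of $A(\mathbb{F}_{q^4})$.
   Context: For a finite field $F$ of odd characteristic, $V(F)=\{(a,b)\in F^2: a\neq 0,\ b\neq 0,\ a\neq \pm b\}$. For $(a,b)\in V(F)$: if $ab$ is a square in $F^\times$, $\mathrm{AGM}(a,b)=\{(\tfrac{a+b}{2},s),(\tfrac{a+b}{2},-s)\}$ with $s^2=ab$; otherwise $\mathrm{AGM}(a,b)=\varnothing$. The aquarium $A(F)$ is the directed graph on $V(F)$ with an edge $(a,b)\to(a',b')$ iff $(a',b')\in\mathrm{AGM}(a,b)$; $V(\mathbb{F}_q)\subseteq V(\mathbb{F}_{q^2})\subseteq V(\mathbb{F}_{q^4})$. $\lambda(a,b)=b^2/a^2$. For $\lambda\neq 0,1$, $\Lambda_\lambda=\{\lambda,\frac1\lambda,1-\lambda,\frac1{1-\lambda},\frac{\lambda}{\lambda-1},\frac{\lambda-1}{\lambda}\}$. -}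

module Defs where

open import Level using (0ℓ)
open import Data.Nat as ℕ using (ℕ; zero; suc)
open import Data.Nat.Primality using (Prime)
open import Data.Fin using (Fin)
open import Data.Product using (Σ; ∃; _×_; _,_)
open import Data.Sum using (_⊎_)
open import Relation.Nullary using (¬_)
open import Relation.Binary.PropositionalEquality using (_≡_)
open import Relation.Binary.Construct.Closure.Equivalence using (EqClosure)
open import Algebra.Structures using (IsCommutativeRing)
open import Function.Bundles using (_↔_)

OddPrimePower : ℕ → Set
OddPrimePower q = Σ ℕ λ p → Σ ℕ λ k → Prime p × ¬ (p ≡ 2) × (1 ℕ.≤ k) × (q ≡ p ℕ.^ k)

record Field : Set₁ where
  infixl 7 _*_
  infixl 6 _+_
  field
    Carrier : Set
    _+_ _*_ : Carrier → Carrier → Carrier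
    -_      : Carrier → Carrier
    0# 1#   : Carrier
    isCommutativeRing : IsCommutativeRing _≡_ _+_ _*_ -_ 0# 1#
    0≢1     : ¬ (0# ≡ 1#)
    inverse : ∀ x → ¬ (x ≡ 0#) → Σ Carrier λ y → x * y ≡ 1#

record FiniteField (n : ℕ) : Set₁ where
  field
    field′ : Field
  open Field field′ public
  field
    enumeration : Carrier ↔ Fin n

module FieldNotions (K : Field) where
  open Field K

  2# : Carrier
  2# = 1# + 1#

  infixr 8 _^ᶠ_
  _^ᶠ_ : Carrier → ℕ → Carrier
  x ^ᶠ zero  = 1#
  x ^ᶠ suc n = x * (x ^ᶠ n)

  -- membership in the subfield F_m = { x | x ^ m = x } (of F_{q^4} for m ∣ q^4 a power of q)
  InSubfield : ℕ → Carrier → Set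
  InSubfield m x = x ^ᶠ m ≡ x

  InV : Carrier × Carrier → Set
  InV (a , b) = ¬ (a ≡ 0#) × ¬ (b ≡ 0#) × ¬ (a ≡ b) × ¬ (a ≡ - b)

  InVSub : ℕ → Carrier × Carrier → Set
  InVSub m (a , b) = InV (a , b) × InSubfield m a × InSubfield m b

  -- (a',b') ∈ AGM(a,b): ab is a square s², a' = (a+b)/2 and b' = ± s
  -- (b' = ± s for some s with s² = ab  ⇔  b'² = ab)
  InAGM : Carrier × Carrier → Carrier × Carrier → Set
  InAGM (a , b) (a′ , b′) =
    (Σ Carrier λ s → s * s ≡ a * b) ×
    (2# * a′ ≡ a + b) ×
    (Σ Carrier λ s → s * s ≡ a * b × (b′ ≡ s ⊎ b′ ≡ - s))

  Edge : Carrier × Carrier → Carrier × Carrier → Set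
  Edge x y = InV x × InV y × InAGM x y

  SameComponent : Carrier × Carrier → Carrier × Carrier → Set
  SameComponent = EqClosure Edge

  -- λ(a,b) = b²/a², characterized by a² · λ = b² (a ≠ 0)
  IsLambda : Carrier × Carrier → Carrier → Set
  IsLambda (a , b) l = (a * a) * l ≡ b * b

  -- l′ ∈ Λ_l = {l, 1/l, 1-l, 1/(1-l), l/(l-1), (l-1)/l}, written with
  -- denominators cleared (all denominators are nonzero since l ≠ 0,1)
  InΛ : Carrier → Carrier → Set
  InΛ l l′ =
    (l′ ≡ l) ⊎
    (l * l′ ≡ 1#) ⊎
    (l′ ≡ 1# + - l) ⊎
    ((1# + - l) * l′ ≡ 1#) ⊎
    ((l + - 1#) * l′ ≡ l) ⊎
    (l * l′ ≡ l + - 1#)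

-- Two moves inside a connected component of the aquarium generate the action of S₃ on Λ_λ.
-- (x, y) and (y, x) have the common AGM successor ((x + y)/2, √(xy)), which realises λ ↦ 1/λ;
-- and for r² = x² - y², j² = -y², w² = xr a path of length four joins (x, y) to (r, j), which
-- realises λ ↦ λ/(λ - 1). Over F_{q⁴} all the square roots exist: by Euler's criterion, proved
-- with Wilson's theorem, every element of F_{q²} is a square in F_{q⁴}, and square roots of
-- elements of F_q already lie in F_{q²}. F_q is closed under addition because q is a power of the
-- characteristic (Frobenius), so starting from F_q everything stays in F_{q²}.

module Submission where

open import Defs
open import Level using (0ℓ)
open import Algebra.Bundles using (CommutativeRing)
open import Data.Fin as Fin using (Fin)
import Data.Fin.Properties as Fin
open import Data.Integer as ℤ using (ℤ; -[1+_]; _⊖_; _◃_)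
import Data.Integer.Properties as ℤ
open import Data.List using (List; []; _∷_; length; foldr; map; filter; allFin)
open import Data.List.Properties using (length-map; length-tabulate)
open import Data.List.Membership.Propositional using (_∈_; lose)
import Data.List.Membership.Propositional.Properties as ∈
open import Data.List.Membership.Propositional.Properties.WithK using (unique∧set⇒bag)
open import Data.List.Relation.Binary.BagAndSetEquality using (∼bag⇒↭)
open import Data.List.Relation.Binary.Permutation.Propositional using (_↭_; ↭-prep; ↭-trans; ↭⇒↭ₛ)
open import Data.List.Relation.Binary.Permutation.Propositional.Properties using (↭-length)
open import Data.List.Relation.Binary.Permutation.Setoid.Properties using (foldr-commMonoid)
open import Data.List.Relation.Unary.All as All using (All)
open import Data.List.Relation.Unary.Any using (here; there; any?; satisfied)
open import Data.List.Relation.Unary.Unique.Propositional using (Unique; _∷_)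
import Data.List.Relation.Unary.Unique.Propositional.Properties as Unique
open import Data.Maybe using (Maybe; just; nothing)
open import Data.Nat as ℕ using (ℕ; zero; suc; _<_; _≤_; _^_; _!; _∸_; z≤n; s≤s)
import Data.Nat.Properties as ℕ
open import Data.Nat.Combinatorics using (_C_; nCn≡1; k![n∸k]!∣n!)
open import Data.Nat.Combinatorics.Specification using (nCk≡n!/k![n-k]!)
open import Data.Nat.Divisibility using (_∣_; _∤_; divides; m∣m*n; ∣1⇒≡1; ∣⇒≤)
open import Data.Nat.DivMod using (m/n*n≡m)
open import Data.Nat.Primality using (Prime; euclidsLemma; prime⇒irreducible; ¬prime[1])
open import Data.Nat.Tactic.RingSolver using (solve-∀)
open import Data.Product using (Σ; ∃; _×_; _,_; proj₁; proj₂)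
open import Data.Sign as Sign using (Sign)
open import Data.Sum using (_⊎_; inj₁; inj₂)
open import Function.Bundles using (_⇔_; mk⇔; Inverse)
open import Function.Properties.Inverse using (↔⇒↣)
open import Relation.Binary.Definitions using (DecidableEquality)
import Relation.Binary.PropositionalEquality as ≡
open ≡ using (_≡_; _≢_; refl; sym; trans; cong; cong₂; subst; module ≡-Reasoning)
open import Relation.Binary.Construct.Closure.ReflexiveTransitive using (ε; _◅_; _◅◅_)
open import Relation.Binary.Construct.Closure.Symmetric using (fwd; bwd)
open import Relation.Nullary using (yes; no; ¬?; contradiction)
import Algebra.Solver.Ring.AlmostCommutativeRing as ACR

-- Integers act through the multiples n · 1# of Semiring.Mult.TCOptimised, under which the
-- coefficient 2 denotes exactly 1# + 1#, the 2# of FieldNotions.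
module IntegerCoefficientRingSolver {c ℓ} (R : CommutativeRing c ℓ) where
  open CommutativeRing R hiding (refl; sym; trans; reflexive)
  module R = CommutativeRing R
  open import Algebra.Properties.Ring ring
    using (-0#≈0#; -‿involutive; -‿+-comm; -‿distribˡ-*; -‿distribʳ-*)
  open import Algebra.Properties.CommutativeSemigroup +-commutativeSemigroup
    using (interchange)
  open import Algebra.Properties.Semiring.Mult.TCOptimised semiring
    using (×-homo-+; ×1-homo-*) renaming (_×_ to _·_)
  open import Relation.Binary.Reasoning.Setoid setoid

  ⟦_⟧ : ℤ → Carrier
  ⟦ ℤ.+ n ⟧ = n · 1#
  ⟦ -[1+ n ] ⟧ = - (suc n · 1#)

  ⟦-⟧ : ∀ i → ⟦ ℤ.- i ⟧ ≈ - ⟦ i ⟧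
  ⟦-⟧ (ℤ.+ zero) = R.sym -0#≈0#
  ⟦-⟧ (ℤ.+ suc n) = R.refl
  ⟦-⟧ -[1+ n ] = R.sym (-‿involutive _)

  ⟦⊖⟧ : ∀ m n → ⟦ m ⊖ n ⟧ ≈ m · 1# - n · 1#
  ⟦⊖⟧ zero zero = R.sym (-‿inverseʳ 0#)
  ⟦⊖⟧ (suc m) zero = R.sym (R.trans (+-congˡ -0#≈0#) (+-identityʳ _))
  ⟦⊖⟧ zero (suc n) = R.sym (+-identityˡ _)
  ⟦⊖⟧ (suc m) (suc n) = begin
    ⟦ suc m ⊖ suc n ⟧                  ≡⟨ cong ⟦_⟧ (ℤ.[1+m]⊖[1+n]≡m⊖n m n) ⟩
    ⟦ m ⊖ n ⟧                          ≈⟨ ⟦⊖⟧ m n ⟩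
    m · 1# - n · 1#                    ≈⟨ +-identityˡ _ ⟨
    0# + (m · 1# - n · 1#)             ≈⟨ +-congʳ (-‿inverseʳ 1#) ⟨
    (1# - 1#) + (m · 1# - n · 1#)      ≈⟨ interchange 1# (- 1#) _ _ ⟩
    (1# + m · 1#) + (- 1# - n · 1#)    ≈⟨ +-congˡ (-‿+-comm 1# _) ⟩
    (1# + m · 1#) - (1# + n · 1#)      ≈⟨ +-cong (×-homo-+ 1# 1 m) (-‿cong (×-homo-+ 1# 1 n)) ⟨
    suc m · 1# - suc n · 1#            ∎

  ⟦+⟧ : ∀ i j → ⟦ i ℤ.+ j ⟧ ≈ ⟦ i ⟧ + ⟦ j ⟧
  ⟦+⟧ (ℤ.+ m) (ℤ.+ n) = ×-homo-+ 1# m n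
  ⟦+⟧ (ℤ.+ m) -[1+ n ] = ⟦⊖⟧ m (suc n)
  ⟦+⟧ -[1+ m ] (ℤ.+ n) = R.trans (⟦⊖⟧ n (suc m)) (+-comm _ _)
  ⟦+⟧ -[1+ m ] -[1+ n ] = begin
    - (suc (suc (m ℕ.+ n)) · 1#)           ≡⟨ cong (λ k → - (k · 1#)) (ℕ.+-suc (suc m) n) ⟨
    - ((suc m ℕ.+ suc n) · 1#)             ≈⟨ -‿cong (×-homo-+ 1# (suc m) (suc n)) ⟩
    - (suc m · 1# + suc n · 1#)            ≈⟨ -‿+-comm _ _ ⟨
    - (suc m · 1#) + - (suc n · 1#)        ∎

  signed : Sign → Carrier → Carrier
  signed Sign.+ x = x
  signed Sign.- x = - x

  ⟦◃⟧ : ∀ s n → ⟦ s ◃ n ⟧ ≈ signed s (n · 1#)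
  ⟦◃⟧ Sign.+ zero = R.refl
  ⟦◃⟧ Sign.- zero = R.sym -0#≈0#
  ⟦◃⟧ Sign.+ (suc n) = R.refl
  ⟦◃⟧ Sign.- (suc n) = R.refl

  signed-* : ∀ s t x y → signed (s Sign.* t) (x * y) ≈ signed s x * signed t y
  signed-* Sign.+ Sign.+ x y = R.refl
  signed-* Sign.+ Sign.- x y = -‿distribʳ-* x y
  signed-* Sign.- Sign.+ x y = -‿distribˡ-* x y
  signed-* Sign.- Sign.- x y = begin
    x * y             ≈⟨ -‿involutive _ ⟨
    - - (x * y)       ≈⟨ -‿cong (-‿distribʳ-* x y) ⟩
    - (x * - y)       ≈⟨ -‿distribˡ-* x (- y) ⟩
    - x * - y         ∎

  ⟦*⟧ : ∀ i j → ⟦ i ℤ.* j ⟧ ≈ ⟦ i ⟧ * ⟦ j ⟧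
  ⟦*⟧ i j = begin
    ⟦ i ℤ.* j ⟧                                                         ≈⟨ ⟦◃⟧ s (ℤ.∣ i ∣ ℕ.* ℤ.∣ j ∣) ⟩
    signed s ((ℤ.∣ i ∣ ℕ.* ℤ.∣ j ∣) · 1#)                              ≈⟨ signed-cong s (×1-homo-* ℤ.∣ i ∣ ℤ.∣ j ∣) ⟩
    signed s (ℤ.∣ i ∣ · 1# * ℤ.∣ j ∣ · 1#)                             ≈⟨ signed-* (ℤ.sign i) (ℤ.sign j) _ _ ⟩
    signed (ℤ.sign i) (ℤ.∣ i ∣ · 1#) * signed (ℤ.sign j) (ℤ.∣ j ∣ · 1#) ≈⟨ *-cong (sign-abs i) (sign-abs j) ⟩
    ⟦ i ⟧ * ⟦ j ⟧                                                       ∎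
    where
      s = ℤ.sign i Sign.* ℤ.sign j
      signed-cong : ∀ s {x y} → x ≈ y → signed s x ≈ signed s y
      signed-cong Sign.+ x≈y = x≈y
      signed-cong Sign.- x≈y = -‿cong x≈y
      sign-abs : ∀ k → signed (ℤ.sign k) (ℤ.∣ k ∣ · 1#) ≈ ⟦ k ⟧
      sign-abs k = R.trans (R.sym (⟦◃⟧ (ℤ.sign k) ℤ.∣ k ∣)) (R.reflexive (cong ⟦_⟧ (ℤ.◃-inverse k)))

  homomorphism : CommutativeRing.rawRing ℤ.+-*-commutativeRing ACR.-Raw-AlmostCommutative⟶ ACR.fromCommutativeRing R
  homomorphism = record
    { ⟦_⟧ = ⟦_⟧ ; +-homo = ⟦+⟧ ; *-homo = ⟦*⟧ ; -‿homo = ⟦-⟧ ; 0-homo = R.refl ; 1-homo = R.refl }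

  ⟦_⟧≟_ : ∀ i j → Maybe (⟦ i ⟧ ≈ ⟦ j ⟧)
  ⟦ i ⟧≟ j with i ℤ.≟ j
  ... | yes i≡j = just (R.reflexive (cong ⟦_⟧ i≡j))
  ... | no _ = nothing

  open import Algebra.Solver.Ring _ _ homomorphism ⟦_⟧≟_ public
    using (Polynomial; solve; _:=_; con; _:+_; _:*_; :-_; _:-_)

  κ : ∀ {n} → ℕ → Polynomial n
  κ k = con (ℤ.+ k)

Odd : ℕ → Set
Odd n = ∃ λ g → n ≡ suc (2 ℕ.* g)

even⊎odd : ∀ n → (∃ λ g → n ≡ 2 ℕ.* g) ⊎ Odd n
even⊎odd zero = inj₁ (0 , refl)
even⊎odd (suc n) with even⊎odd n
... | inj₁ (g , refl) = inj₂ (g , refl)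
... | inj₂ (g , refl) = inj₁ (suc g , sym (ℕ.*-suc 2 g))

prime⇒odd : ∀ {p} → Prime p → p ≢ 2 → Odd p
prime⇒odd {p} pp p≢2 with even⊎odd p
... | inj₂ odd = odd
... | inj₁ (g , refl) with prime⇒irreducible pp (m∣m*n g)
...   | inj₁ ()
...   | inj₂ 2≡p = contradiction (sym 2≡p) p≢2

odd-* : ∀ {m n} → Odd m → Odd n → Odd (m ℕ.* n)
odd-* (g , refl) (h , refl) = g ℕ.+ h ℕ.+ 2 ℕ.* g ℕ.* h , lemma g h
  where
    lemma : ∀ g h → suc (2 ℕ.* g) ℕ.* suc (2 ℕ.* h) ≡ suc (2 ℕ.* (g ℕ.+ h ℕ.+ 2 ℕ.* g ℕ.* h))
    lemma = solve-∀

odd-^ : ∀ {n} → Odd n → ∀ k → Odd (n ^ k)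
odd-^ odd zero = 0 , refl
odd-^ odd (suc k) = odd-* odd (odd-^ odd k)

odd-square : ∀ g → suc (2 ℕ.* g) ^ 2 ≡ suc (2 ℕ.* (2 ℕ.* g ℕ.* suc g))
odd-square g = lemma g
  where
    lemma : ∀ g → suc (2 ℕ.* g) ℕ.* (suc (2 ℕ.* g) ℕ.* 1) ≡ suc (2 ℕ.* (2 ℕ.* g ℕ.* suc g))
    lemma = solve-∀

^4≡^2^2 : ∀ n → n ^ 4 ≡ (n ^ 2) ^ 2
^4≡^2^2 n = lemma n
  where
    lemma : ∀ n → n ℕ.* (n ℕ.* (n ℕ.* (n ℕ.* 1))) ≡ (n ℕ.* (n ℕ.* 1)) ℕ.* ((n ℕ.* (n ℕ.* 1)) ℕ.* 1)
    lemma = solve-∀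

prime∤! : ∀ {p} → Prime p → ∀ m → m < p → p ∤ m !
prime∤! pp zero _ p∣1 = ¬prime[1] (subst Prime (∣1⇒≡1 p∣1) pp)
prime∤! pp (suc m) m<p p∣m! with euclidsLemma (suc m) (m !) pp p∣m!
... | inj₁ p∣1+m = ℕ.<⇒≱ m<p (∣⇒≤ p∣1+m)
... | inj₂ p∣m!  = prime∤! pp m (ℕ.<-trans (ℕ.n<1+n m) m<p) p∣m!

C*k!*[n∸k]!≡n! : ∀ {n k} → k ≤ n → (n C k) ℕ.* (k ! ℕ.* (n ∸ k) !) ≡ n !
C*k!*[n∸k]!≡n! {n} {k} k≤n = trans (cong (ℕ._* (k ! ℕ.* (n ∸ k) !)) (nCk≡n!/k![n-k]! k≤n))
  (m/n*n≡m {{ℕ.m*n≢0 (k !) ((n ∸ k) !) {{ℕ._!≢0 k}} {{ℕ._!≢0 (n ∸ k)}}}} (k![n∸k]!∣n! k≤n))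

prime∣C : ∀ {p k} → Prime p → 0 < k → k < p → p ∣ p C k
prime∣C {p@(suc p-1)} {k} pp 0<k k<p
  with euclidsLemma (p C k) (k ! ℕ.* (p ∸ k) !) pp
         (subst (p ∣_) (sym (C*k!*[n∸k]!≡n! (ℕ.<⇒≤ k<p))) (m∣m*n (p-1 !)))
... | inj₁ p∣C = p∣C
... | inj₂ p∣k!*[p∸k]! with euclidsLemma (k !) ((p ∸ k) !) pp p∣k!*[p∸k]!
...   | inj₁ p∣k! = contradiction p∣k! (prime∤! pp k k<p)
...   | inj₂ p∣[p∸k]! = contradiction p∣[p∸k]! (prime∤! pp (p ∸ k) (ℕ.∸-monoʳ-< {p} {k} {0} 0<k (ℕ.<⇒≤ k<p)))

unique∧set⇒↭ : ∀ {a} {A : Set a} {xs ys : List A} →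
  Unique xs → Unique ys → (∀ {x} → x ∈ xs ⇔ x ∈ ys) → xs ↭ ys
unique∧set⇒↭ u v xs⇔ys = ∼bag⇒↭ (unique∧set⇒bag u v xs⇔ys)

module Removal {a} {A : Set a} (_≟_ : DecidableEquality A) where

  infixl 6 _∖_
  _∖_ : List A → A → List A
  xs ∖ x = filter (λ y → ¬? (y ≟ x)) xs

  ∈-∖⁺ : ∀ {xs x y} → y ∈ xs → y ≢ x → y ∈ xs ∖ x
  ∈-∖⁺ {x = x} = ∈.∈-filter⁺ (λ y → ¬? (y ≟ x))

  ∈-∖⁻ : ∀ xs {x y} → y ∈ xs ∖ x → y ∈ xs × y ≢ x
  ∈-∖⁻ xs {x} = ∈.∈-filter⁻ (λ y → ¬? (y ≟ x)) {xs = xs}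

  ∖-unique : ∀ {xs} x → Unique xs → Unique (xs ∖ x)
  ∖-unique x = Unique.filter⁺ (λ y → ¬? (y ≟ x))

  ↭-∖ : ∀ {xs x} → Unique xs → x ∈ xs → xs ↭ x ∷ xs ∖ x
  ↭-∖ {xs} {x} u x∈xs = unique∧set⇒↭ u (x∉xs∖x ∷ ∖-unique x u) (mk⇔ to from)
    where
      x∉xs∖x : All (x ≢_) (xs ∖ x)
      x∉xs∖x = All.tabulate λ y∈xs∖x x≡y → proj₂ (∈-∖⁻ xs y∈xs∖x) (sym x≡y)
      to : ∀ {y} → y ∈ xs → y ∈ x ∷ xs ∖ x
      to {y} y∈xs with y ≟ x
      ... | yes refl = here refl
      ... | no y≢x = there (∈-∖⁺ y∈xs y≢x)
      from : ∀ {y} → y ∈ x ∷ xs ∖ x → y ∈ xs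
      from (here refl) = x∈xs
      from (there y∈xs∖x) = proj₁ (∈-∖⁻ xs y∈xs∖x)

  ↭-∖∖ : ∀ {xs x y} → Unique xs → x ∈ xs → y ∈ xs → y ≢ x → xs ↭ x ∷ y ∷ xs ∖ x ∖ y
  ↭-∖∖ {x = x} xs! x∈xs y∈xs y≢x =
    ↭-trans (↭-∖ xs! x∈xs) (↭-prep x (↭-∖ (∖-unique x xs!) (∈-∖⁺ y∈xs y≢x)))

  ∈-∖∖⁻ : ∀ xs {x y t} → t ∈ xs ∖ x ∖ y → t ∈ xs × t ≢ x × t ≢ y
  ∈-∖∖⁻ xs {x} t∈ with ∈-∖⁻ (xs ∖ x) t∈
  ... | t∈xs∖x , t≢y = proj₁ (∈-∖⁻ xs t∈xs∖x) , proj₂ (∈-∖⁻ xs t∈xs∖x) , t≢y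

module FieldTheory (F : Field) where

  open Field F
  open FieldNotions F

  commutativeRing : CommutativeRing 0ℓ 0ℓ
  commutativeRing = record { isCommutativeRing = isCommutativeRing }

  open CommutativeRing commutativeRing public
    using ( _-_; +-comm; *-assoc; *-comm; +-identityˡ; +-identityʳ; *-identityˡ; *-identityʳ
          ; -‿inverseʳ; distribʳ; zeroˡ; zeroʳ; semiring; commutativeSemiring
          ; +-isCommutativeMonoid; *-isCommutativeMonoid)
  open import Algebra.Properties.Ring (CommutativeRing.ring commutativeRing)
    using (-‿involutive; x∙y⁻¹≈ε⇒x≈y; x≈y⇒x∙y⁻¹≈ε; -0#≈0#)
  open import Algebra.Properties.Semiring.Mult.TCOptimised semiring using (×-homo-+; ×1-homo-*)
    renaming (_×_ to _·_)
  open IntegerCoefficientRingSolver commutativeRing public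
    using (solve; _:=_; κ; _:+_; _:*_; :-_; _:-_)
  open ≡-Reasoning

  1≢0 : 1# ≢ 0#
  1≢0 1≡0 = 0≢1 (sym 1≡0)

  *-cancelˡ : ∀ {x y z} → x ≢ 0# → x * y ≡ x * z → y ≡ z
  *-cancelˡ {x} {y} {z} x≢0 xy≡xz = begin
    y              ≡⟨ *-identityˡ y ⟨
    1# * y         ≡⟨ cong (_* y) x′x≡1 ⟨
    (x′ * x) * y   ≡⟨ *-assoc x′ x y ⟩
    x′ * (x * y)   ≡⟨ cong (x′ *_) xy≡xz ⟩
    x′ * (x * z)   ≡⟨ *-assoc x′ x z ⟨
    (x′ * x) * z   ≡⟨ cong (_* z) x′x≡1 ⟩
    1# * z         ≡⟨ *-identityˡ z ⟩
    z              ∎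
    where
      x′ = proj₁ (inverse x x≢0)
      x′x≡1 : x′ * x ≡ 1#
      x′x≡1 = trans (*-comm x′ x) (proj₂ (inverse x x≢0))

  *≢0 : ∀ {x y} → x ≢ 0# → y ≢ 0# → x * y ≢ 0#
  *≢0 {x} x≢0 y≢0 xy≡0 = y≢0 (*-cancelˡ x≢0 (trans xy≡0 (sym (zeroʳ x))))

  *≢0⇒ˡ : ∀ {x y} → x * y ≢ 0# → x ≢ 0#
  *≢0⇒ˡ {x} {y} xy≢0 refl = xy≢0 (zeroˡ y)

  *≢0⇒ʳ : ∀ {x y} → x * y ≢ 0# → y ≢ 0#
  *≢0⇒ʳ {x} {y} xy≢0 refl = xy≢0 (zeroʳ x)

  -≢0 : ∀ {x} → x ≢ 0# → - x ≢ 0#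
  -≢0 {x} x≢0 -x≡0 = x≢0 (trans (sym (-‿involutive x)) (trans (cong -_ -x≡0) -0#≈0#))

  -≢0⇒≢ : ∀ {x y} → x - y ≢ 0# → x ≢ y
  -≢0⇒≢ {x} x-y≢0 refl = x-y≢0 (-‿inverseʳ x)

  ≢⇒-≢0 : ∀ {x y} → x ≢ y → x - y ≢ 0#
  ≢⇒-≢0 {x} {y} x≢y x-y≡0 = x≢y (x∙y⁻¹≈ε⇒x≈y x y x-y≡0)

  ≢-⇒+≢0 : ∀ {x y} → x ≢ - y → x + y ≢ 0#
  ≢-⇒+≢0 {x} {y} x≢-y x+y≡0 = x≢-y (x∙y⁻¹≈ε⇒x≈y x (- y) (trans (cong (x +_) (-‿involutive y)) x+y≡0))

  square≢0 : ∀ {x} → x ≢ 0# → x * x ≢ 0#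
  square≢0 x≢0 = *≢0 x≢0 x≢0

  root≢0 : ∀ {x y} → y * y ≡ x → x ≢ 0# → y ≢ 0#
  root≢0 {x} {y} y²≡x x≢0 refl = x≢0 (trans (sym y²≡x) (zeroˡ 0#))

  difference-of-squares : ∀ x y → (x - y) * (x + y) ≡ x * x - y * y
  difference-of-squares = solve 2 (λ x y → (x :- y) :* (x :+ y) := x :* x :- y :* y) refl

  squares≢ : ∀ {x y} → x ≢ y → x ≢ - y → x * x ≢ y * y
  squares≢ {x} {y} x≢y x≢-y x²≡y² =
    *≢0 (≢⇒-≢0 x≢y) (≢-⇒+≢0 x≢-y) (trans (difference-of-squares x y) (x≈y⇒x∙y⁻¹≈ε x²≡y²))

  ι : ℕ → Carrier
  ι n = n · 1#

  ι-+ : ∀ m n → ι (m ℕ.+ n) ≡ ι m + ι n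
  ι-+ = ×-homo-+ 1#

  ι-* : ∀ m n → ι (m ℕ.* n) ≡ ι m * ι n
  ι-* = ×1-homo-*

  ι-^ : ∀ m n → ι (m ^ n) ≡ ι m ^ᶠ n
  ι-^ m zero = refl
  ι-^ m (suc n) = trans (ι-* m (m ^ n)) (cong (ι m *_) (ι-^ m n))

  ^ᶠ-+ : ∀ x m n → x ^ᶠ (m ℕ.+ n) ≡ x ^ᶠ m * x ^ᶠ n
  ^ᶠ-+ x zero n = sym (*-identityˡ _)
  ^ᶠ-+ x (suc m) n = trans (cong (x *_) (^ᶠ-+ x m n)) (sym (*-assoc x _ _))

  ^ᶠ-* : ∀ x m n → x ^ᶠ (m ℕ.* n) ≡ (x ^ᶠ m) ^ᶠ n
  ^ᶠ-* x m zero = cong (x ^ᶠ_) (ℕ.*-zeroʳ m)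
  ^ᶠ-* x m (suc n) = begin
    x ^ᶠ (m ℕ.* suc n)        ≡⟨ cong (x ^ᶠ_) (ℕ.*-suc m n) ⟩
    x ^ᶠ (m ℕ.+ m ℕ.* n)      ≡⟨ ^ᶠ-+ x m (m ℕ.* n) ⟩
    x ^ᶠ m * x ^ᶠ (m ℕ.* n)   ≡⟨ cong (x ^ᶠ m *_) (^ᶠ-* x m n) ⟩
    x ^ᶠ m * (x ^ᶠ m) ^ᶠ n    ∎

  *-^ᶠ : ∀ x y n → (x * y) ^ᶠ n ≡ x ^ᶠ n * y ^ᶠ n
  *-^ᶠ x y zero = sym (*-identityˡ 1#)
  *-^ᶠ x y (suc n) = trans (cong ((x * y) *_) (*-^ᶠ x y n))
    (solve 4 (λ x y a b → (x :* y) :* (a :* b) := (x :* a) :* (y :* b)) refl x y _ _)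

  1^ᶠ : ∀ n → 1# ^ᶠ n ≡ 1#
  1^ᶠ zero = refl
  1^ᶠ (suc n) = trans (*-identityˡ _) (1^ᶠ n)

  ^ᶠ≢0 : ∀ {x} n → x ≢ 0# → x ^ᶠ n ≢ 0#
  ^ᶠ≢0 zero x≢0 = 1≢0
  ^ᶠ≢0 (suc n) x≢0 = *≢0 x≢0 (^ᶠ≢0 n x≢0)

  ι-∣ : ∀ {m n} → m ∣ n → ι m ≡ 0# → ι n ≡ 0#
  ι-∣ {m} (divides c refl) ι[m]≡0 = trans (ι-* c m) (trans (cong (ι c *_) ι[m]≡0) (zeroʳ (ι c)))

  module _ where
    open import Algebra.Properties.CommutativeSemiring.Binomial commutativeSemiring
      using (theorem; binomialTerm)
    open import Algebra.Properties.Semiring.Mult semiring using (×-assoc-*) renaming (_×_ to _×ᵤ_)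
    open import Algebra.Properties.Semiring.Sum semiring using (sum; sum-init-last; sum-cong-≋; sum-replicate-zero)
    open import Algebra.Properties.Semiring.Mult.TCOptimised semiring using (×ᵤ≈×)
    open import Algebra.Properties.Semiring.Exp semiring using () renaming (_^_ to _^ᵉ_)
    open import Data.Vec.Functional using (tail; init; last)

    private
      ^ᶠ≡^ᵉ : ∀ x n → x ^ᶠ n ≡ x ^ᵉ n
      ^ᶠ≡^ᵉ x zero = refl
      ^ᶠ≡^ᵉ x (suc n) = cong (x *_) (^ᶠ≡^ᵉ x n)

      ×ᵤ≡ι* : ∀ n z → n ×ᵤ z ≡ ι n * z
      ×ᵤ≡ι* n z = begin
        n ×ᵤ z          ≡⟨ cong (n ×ᵤ_) (*-identityˡ z) ⟨
        n ×ᵤ (1# * z)   ≡⟨ ×-assoc-* n 1# z ⟨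
        (n ×ᵤ 1#) * z   ≡⟨ cong (_* z) (×ᵤ≈× n 1#) ⟩
        ι n * z         ∎

    freshman's-dream : ∀ n → (∀ {k} → 0 < k → k < suc n → ι (suc n C k) ≡ 0#) →
                       ∀ x y → (x + y) ^ᶠ suc n ≡ x ^ᶠ suc n + y ^ᶠ suc n
    freshman's-dream n inner≡0 x y = begin
      (x + y) ^ᶠ suc n                               ≡⟨ ^ᶠ≡^ᵉ (x + y) (suc n) ⟩
      (x + y) ^ᵉ suc n                               ≡⟨ theorem (suc n) x y ⟩
      t Fin.zero + sum (tail t)                      ≡⟨ cong (t Fin.zero +_) (sum-init-last (tail t)) ⟩
      t Fin.zero + (sum (init (tail t)) + last (tail t)) ≡⟨ cong₂ (λ a b → a + (b + last (tail t))) first middle ⟩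
      y ^ᶠ suc n + (0# + last (tail t))              ≡⟨ cong (λ b → y ^ᶠ suc n + (0# + b)) final ⟩
      y ^ᶠ suc n + (0# + x ^ᶠ suc n)                 ≡⟨ solve 2 (λ a b → b :+ (κ 0 :+ a) := a :+ b) refl _ _ ⟩
      x ^ᶠ suc n + y ^ᶠ suc n                        ∎
      where
        t = binomialTerm x y (suc n)
        first : t Fin.zero ≡ y ^ᶠ suc n
        first = trans (+-identityʳ _) (trans (*-identityˡ _) (sym (^ᶠ≡^ᵉ y (suc n))))
        inner : ∀ i → init (tail t) i ≡ 0#
        inner i = trans (×ᵤ≡ι* (suc n C k) b) (trans (cong (_* b) (inner≡0 (s≤s z≤n) k<1+n)) (zeroˡ b))
          where
            k = suc (Fin.toℕ (Fin.inject₁ i))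
            b = x ^ᵉ k * y ^ᵉ (suc n ∸ k)
            k<1+n : k < suc n
            k<1+n = s≤s (subst (_< n) (sym (Fin.toℕ-inject₁ i)) (Fin.toℕ<n i))
        middle : sum (init (tail t)) ≡ 0#
        middle = trans (sum-cong-≋ inner) (sum-replicate-zero n)
        final : last (tail t) ≡ x ^ᶠ suc n
        final = begin
          term m                                          ≡⟨ cong term (Fin.toℕ-fromℕ n) ⟩
          term n                                          ≡⟨ cong₂ (λ c e → c ×ᵤ (x ^ᵉ suc n * y ^ᵉ e)) (nCn≡1 (suc n)) (ℕ.n∸n≡0 n) ⟩
          (x ^ᵉ suc n * 1#) + 0#                          ≡⟨ trans (+-identityʳ _) (*-identityʳ _) ⟩
          x ^ᵉ suc n                                      ≡⟨ ^ᶠ≡^ᵉ x (suc n) ⟨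
          x ^ᶠ suc n                                      ∎
          where
            m = Fin.toℕ (Fin.fromℕ n)
            term : ℕ → Carrier
            term i = (suc n C suc i) ×ᵤ (x ^ᵉ suc i * y ^ᵉ (n ∸ i))

  frobenius : ∀ {p} → Prime p → ι p ≡ 0# → ∀ x y → (x + y) ^ᶠ p ≡ x ^ᶠ p + y ^ᶠ p
  frobenius {suc p-1} p-prime char-p =
    freshman's-dream p-1 (λ 0<k k<p → ι-∣ (prime∣C p-prime 0<k k<p) char-p)

  frobenius-^ : ∀ {p} → Prime p → ι p ≡ 0# → ∀ k x y →
                (x + y) ^ᶠ (p ^ k) ≡ x ^ᶠ (p ^ k) + y ^ᶠ (p ^ k)
  frobenius-^ p-prime char-p zero x y = distribʳ 1# x y
  frobenius-^ {p} p-prime char-p (suc k) x y = begin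
    (x + y) ^ᶠ (p ℕ.* p ^ k)                      ≡⟨ ^ᶠ-* (x + y) p (p ^ k) ⟩
    ((x + y) ^ᶠ p) ^ᶠ (p ^ k)                     ≡⟨ cong (_^ᶠ (p ^ k)) (frobenius p-prime char-p x y) ⟩
    (x ^ᶠ p + y ^ᶠ p) ^ᶠ (p ^ k)                  ≡⟨ frobenius-^ p-prime char-p k (x ^ᶠ p) (y ^ᶠ p) ⟩
    (x ^ᶠ p) ^ᶠ (p ^ k) + (y ^ᶠ p) ^ᶠ (p ^ k)     ≡⟨ cong₂ _+_ (^ᶠ-* x p (p ^ k)) (^ᶠ-* y p (p ^ k)) ⟨
    x ^ᶠ (p ℕ.* p ^ k) + y ^ᶠ (p ℕ.* p ^ k)       ∎

  -^ᶠ-odd : ∀ x g → (- x) ^ᶠ suc (2 ℕ.* g) ≡ - (x ^ᶠ suc (2 ℕ.* g))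
  -^ᶠ-odd x g = begin
    - x * (- x) ^ᶠ (2 ℕ.* g)     ≡⟨ cong (- x *_) (^ᶠ-* (- x) 2 g) ⟩
    - x * ((- x) ^ᶠ 2) ^ᶠ g      ≡⟨ cong (λ z → - x * z ^ᶠ g) (solve 1 (λ x → :- x :* (:- x :* κ 1) := x :* (x :* κ 1)) refl x) ⟩
    - x * (x ^ᶠ 2) ^ᶠ g          ≡⟨ cong (- x *_) (^ᶠ-* x 2 g) ⟨
    - x * x ^ᶠ (2 ℕ.* g)         ≡⟨ solve 2 (λ x a → :- x :* a := :- (x :* a)) refl x _ ⟩
    - (x * x ^ᶠ (2 ℕ.* g))       ∎

  InSubfield-+ : ∀ {p} → Prime p → ι p ≡ 0# → ∀ k {x y} →
                 InSubfield (p ^ k) x → InSubfield (p ^ k) y → InSubfield (p ^ k) (x + y)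
  InSubfield-+ p-prime char-p k {x} {y} x∈ y∈ = trans (frobenius-^ p-prime char-p k x y) (cong₂ _+_ x∈ y∈)

  InSubfield-* : ∀ n {x y} → InSubfield n x → InSubfield n y → InSubfield n (x * y)
  InSubfield-* n {x} {y} x∈ y∈ = trans (*-^ᶠ x y n) (cong₂ _*_ x∈ y∈)

  InSubfield-neg : ∀ g {x} → InSubfield (suc (2 ℕ.* g)) x → InSubfield (suc (2 ℕ.* g)) (- x)
  InSubfield-neg g {x} x∈ = trans (-^ᶠ-odd x g) (cong -_ x∈)

  InSubfield-^ : ∀ n {x} → InSubfield n x → ∀ j → InSubfield (n ^ j) x
  InSubfield-^ n {x} x∈ zero = *-identityʳ x
  InSubfield-^ n {x} x∈ (suc j) = begin
    x ^ᶠ (n ℕ.* n ^ j)     ≡⟨ ^ᶠ-* x n (n ^ j) ⟩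
    (x ^ᶠ n) ^ᶠ (n ^ j)    ≡⟨ cong (_^ᶠ (n ^ j)) x∈ ⟩
    x ^ᶠ (n ^ j)           ≡⟨ InSubfield-^ n x∈ j ⟩
    x                      ∎

  fixed⇒^≡1 : ∀ {z} m → z ≢ 0# → z ^ᶠ suc m ≡ z → z ^ᶠ m ≡ 1#
  fixed⇒^≡1 {z} m z≢0 z∈ = *-cancelˡ z≢0 (trans z∈ (sym (*-identityʳ z)))

  -- 2g(g + 1) = (n² - 1) / 2 for n = 2g + 1
  InSubfield⇒^half≡1 : ∀ g {z} → z ≢ 0# → InSubfield (suc (2 ℕ.* g)) z → z ^ᶠ (2 ℕ.* g ℕ.* suc g) ≡ 1#
  InSubfield⇒^half≡1 g {z} z≢0 z∈ = begin
    z ^ᶠ (2 ℕ.* g ℕ.* suc g)      ≡⟨ ^ᶠ-* z (2 ℕ.* g) (suc g) ⟩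
    (z ^ᶠ (2 ℕ.* g)) ^ᶠ suc g     ≡⟨ cong (_^ᶠ suc g) (fixed⇒^≡1 (2 ℕ.* g) z≢0 z∈) ⟩
    1# ^ᶠ suc g                   ≡⟨ 1^ᶠ (suc g) ⟩
    1#                            ∎

  InSubfield-√ : ∀ g {y z} → z ≢ 0# → InSubfield (suc (2 ℕ.* g)) z → y * y ≡ z →
                 InSubfield (suc (2 ℕ.* g) ^ 2) y
  InSubfield-√ g {y} {z} z≢0 z∈ y²≡z = begin
    y ^ᶠ (suc (2 ℕ.* g) ^ 2)      ≡⟨ cong (y ^ᶠ_) (odd-square g) ⟩
    y * y ^ᶠ (2 ℕ.* h)            ≡⟨ cong (y *_) (^ᶠ-* y 2 h) ⟩
    y * (y ^ᶠ 2) ^ᶠ h             ≡⟨ cong (λ t → y * (y * t) ^ᶠ h) (*-identityʳ y) ⟩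
    y * (y * y) ^ᶠ h              ≡⟨ cong (λ t → y * t ^ᶠ h) y²≡z ⟩
    y * z ^ᶠ h                    ≡⟨ cong (y *_) (InSubfield⇒^half≡1 g z≢0 z∈) ⟩
    y * 1#                        ≡⟨ *-identityʳ y ⟩
    y                             ∎
    where h = 2 ℕ.* g ℕ.* suc g

  module Products (_≟_ : DecidableEquality Carrier) where

    open Removal _≟_

    product : List Carrier → Carrier
    product = foldr _*_ 1#

    product-↭ : ∀ {xs ys} → xs ↭ ys → product xs ≡ product ys
    product-↭ xs↭ys = foldr-commMonoid (≡.setoid Carrier) *-isCommutativeMonoid (↭⇒↭ₛ xs↭ys)

    product-paired : ∀ {c} → c ≢ 0# → ∀ m xs → Unique xs → length xs ≡ 2 ℕ.* m →
                     (∀ {x} → x ∈ xs → ∃ λ y → y ∈ xs × x * y ≡ c) →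
                     (∀ {x} → x ∈ xs → x * x ≢ c) →
                     product xs ≡ c ^ᶠ m
    product-paired c≢0 zero [] _ _ _ _ = refl
    product-paired {c} c≢0 (suc m) xs@(x ∷ _) xs! len partner no-fix = begin
      product xs               ≡⟨ product-↭ xs↭ ⟩
      x * (y * product rest)   ≡⟨ *-assoc x y _ ⟨
      (x * y) * product rest   ≡⟨ cong₂ _*_ xy≡c (product-paired c≢0 m rest rest! rest-length rest-partner rest-no-fix) ⟩
      c * c ^ᶠ m               ∎
      where
        y = proj₁ (partner (here refl))
        xy≡c = proj₂ (proj₂ (partner (here refl)))
        y≢x : y ≢ x
        y≢x y≡x = no-fix (here refl) (subst (λ t → x * t ≡ c) y≡x xy≡c)
        rest = xs ∖ x ∖ y
        xs↭ : xs ↭ x ∷ y ∷ rest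
        xs↭ = ↭-∖∖ xs! (here refl) (proj₁ (proj₂ (partner (here refl)))) y≢x
        rest! : Unique rest
        rest! = ∖-unique y (∖-unique x xs!)
        rest-length : length rest ≡ 2 ℕ.* m
        rest-length = ℕ.suc-injective (ℕ.suc-injective (trans (sym (↭-length xs↭)) (trans len (ℕ.*-suc 2 m))))
        cancel : ∀ {a b b′} → a * b ≡ c → a * b′ ≡ c → b ≡ b′
        cancel {a} {b} ab≡c ab′≡c = *-cancelˡ (λ { refl → c≢0 (trans (sym ab≡c) (zeroˡ b)) }) (trans ab≡c (sym ab′≡c))
        rest-partner : ∀ {t} → t ∈ rest → ∃ λ u → u ∈ rest × t * u ≡ c
        rest-partner {t} t∈rest with ∈-∖∖⁻ xs t∈rest
        ... | t∈xs , t≢x , t≢y with partner t∈xs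
        ...   | u , u∈xs , tu≡c = u , ∈-∖⁺ (∈-∖⁺ u∈xs u≢x) u≢y , tu≡c
          where
            u≢x : u ≢ x
            u≢x u≡x = t≢y (cancel (trans (*-comm x t) (subst (λ v → t * v ≡ c) u≡x tu≡c)) xy≡c)
            u≢y : u ≢ y
            u≢y u≡y = t≢x (cancel (trans (*-comm y t) (subst (λ v → t * v ≡ c) u≡y tu≡c)) (trans (*-comm y x) xy≡c))
        rest-no-fix : ∀ {t} → t ∈ rest → t * t ≢ c
        rest-no-fix t∈rest = no-fix (proj₁ (∈-∖∖⁻ xs t∈rest))

  inV : ∀ {x y} → x * y ≢ 0# → x * x ≢ y * y → InV (x , y)
  inV {x} {y} xy≢0 x²≢y² = *≢0⇒ˡ xy≢0 , *≢0⇒ʳ xy≢0 , (λ { refl → x²≢y² refl }) ,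
    λ { refl → x²≢y² (solve 1 (λ y → :- y :* :- y := y :* y) refl y) }

  InV⇒*≢0 : ∀ {x y} → InV (x , y) → x * y ≢ 0#
  InV⇒*≢0 (x≢0 , y≢0 , _) = *≢0 x≢0 y≢0

  InV-sym : ∀ {x y} → InV (x , y) → InV (y , x)
  InV-sym {x} {y} (x≢0 , y≢0 , x≢y , x≢-y) =
    y≢0 , x≢0 , (λ y≡x → x≢y (sym y≡x)) , λ y≡-x → x≢-y (trans (sym (-‿involutive x)) (cong -_ (sym y≡-x)))

  module Aquarium (2≢0 : 2# ≢ 0#) where

    halve : ∀ z → ∃ λ m → 2# * m ≡ z
    halve z = proj₁ (inverse 2# 2≢0) * z ,
      trans (sym (*-assoc 2# _ z)) (trans (cong (_* z) (proj₂ (inverse 2# 2≢0))) (*-identityˡ z))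

    agm-edge : ∀ {x y m s} → InV (x , y) → s * s ≡ x * y → 2# * m ≡ x + y → Edge (x , y) (m , s)
    agm-edge {x} {y} {m} {s} v@(_ , _ , x≢y , x≢-y) s²≡xy 2m≡x+y =
      v , inV (*≢0 m≢0 s≢0) m²≢s² , (s , s²≡xy) , 2m≡x+y , (s , s²≡xy , inj₁ refl)
      where
        m≢0 : m ≢ 0#
        m≢0 refl = ≢-⇒+≢0 x≢-y (trans (sym 2m≡x+y) (zeroʳ 2#))
        s≢0 : s ≢ 0#
        s≢0 = root≢0 s²≡xy (InV⇒*≢0 v)
        m²≢s² : m * m ≢ s * s
        m²≢s² m²≡s² = square≢0 (≢⇒-≢0 x≢y) (begin
          (x - y) * (x - y)                          ≡⟨ solve 2 (λ x y → (x :- y) :* (x :- y) :=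
                                                          (x :+ y) :* (x :+ y) :- (κ 2 :* κ 2) :* (x :* y)) refl x y ⟩
          (x + y) * (x + y) - (2# * 2#) * (x * y)    ≡⟨ cong₂ (λ a b → a * a - (2# * 2#) * b) (sym 2m≡x+y) (sym s²≡xy) ⟩
          (2# * m) * (2# * m) - (2# * 2#) * (s * s)  ≡⟨ solve 2 (λ m s → (κ 2 :* m) :* (κ 2 :* m) :- (κ 2 :* κ 2) :* (s :* s) :=
                                                          (κ 2 :* κ 2) :* (m :* m :- s :* s)) refl m s ⟩
          (2# * 2#) * (m * m - s * s)                ≡⟨ cong (λ a → (2# * 2#) * (a - s * s)) m²≡s² ⟩
          (2# * 2#) * (s * s - s * s)                ≡⟨ solve 2 (λ a b → a :* (b :- b) := κ 0) refl (2# * 2#) (s * s) ⟩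
          0#                                         ∎)

    SameComponent-swap : ∀ {x y s} → InV (x , y) → s * s ≡ x * y → SameComponent (x , y) (y , x)
    SameComponent-swap {x} {y} {s} v s²≡xy =
      fwd (agm-edge v s²≡xy 2m≡x+y) ◅ bwd (agm-edge (InV-sym v) (trans s²≡xy (*-comm x y)) (trans 2m≡x+y (+-comm x y))) ◅ ε
      where
        2m≡x+y = proj₂ (halve (x + y))

    -- (x , y) ← (x + r , x - r) ← (x + r + 2w , x + r - 2w) → (x + r , r - x) → (r , j)
    SameComponent-root-pair : ∀ {x y r w j} → InV (x , y) →
      r * r ≡ x * x - y * y → w * w ≡ x * r → j * j ≡ - (y * y) →
      InV (r , j) × SameComponent (x , y) (r , j)
    SameComponent-root-pair {x} {y} {r} {w} {j} v@(x≢0 , y≢0 , x≢y , x≢-y) r²≡x²-y² w²≡xr j²≡-y² =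
      proj₁ (proj₂ E4) , bwd E3 ◅ bwd E1 ◅ fwd E2 ◅ fwd E4 ◅ ε
      where
        t = x + r
        u = 2# * w
        [x-r]t≡y² : (x - r) * t ≡ y * y
        [x-r]t≡y² = begin
          (x - r) * (x + r)        ≡⟨ difference-of-squares x r ⟩
          x * x - r * r            ≡⟨ cong (λ a → x * x - a) r²≡x²-y² ⟩
          x * x - (x * x - y * y)  ≡⟨ solve 2 (λ x y → x :* x :- (x :* x :- y :* y) := y :* y) refl x y ⟩
          y * y                    ∎
        x-r≢0 : x - r ≢ 0#
        x-r≢0 = *≢0⇒ˡ (λ e → square≢0 y≢0 (trans (sym [x-r]t≡y²) e))
        t≢0 : t ≢ 0#
        t≢0 = *≢0⇒ʳ (λ e → square≢0 y≢0 (trans (sym [x-r]t≡y²) e))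
        r≢0 : r ≢ 0#
        r≢0 = root≢0 r²≡x²-y² (≢⇒-≢0 (squares≢ x≢y x≢-y))
        w≢0 : w ≢ 0#
        w≢0 = root≢0 w²≡xr (*≢0 x≢0 r≢0)
        [t+u][t-u]≡[x-r]² : (t + u) * (t - u) ≡ (x - r) * (x - r)
        [t+u][t-u]≡[x-r]² = begin
          (t + u) * (t - u)                                ≡⟨ solve 3 (λ x r w → (x :+ r :+ κ 2 :* w) :* (x :+ r :- κ 2 :* w) :=
                                                                (x :- r) :* (x :- r) :+ (κ 2 :* κ 2) :* (x :* r :- w :* w)) refl x r w ⟩
          (x - r) * (x - r) + (2# * 2#) * (x * r - w * w)  ≡⟨ cong (λ a → (x - r) * (x - r) + (2# * 2#) * (x * r - a)) w²≡xr ⟩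
          (x - r) * (x - r) + (2# * 2#) * (x * r - x * r)  ≡⟨ solve 3 (λ a b c → a :+ b :* (c :- c) := a) refl _ (2# * 2#) (x * r) ⟩
          (x - r) * (x - r)                                ∎
        vQ : InV (t + u , t - u)
        vQ = inV (λ e → square≢0 x-r≢0 (trans (sym [t+u][t-u]≡[x-r]²) e))
                 (-≢0⇒≢ (λ e → 4tu≢0 (trans (sym [t+u]²-[t-u]²) e)))
          where
            [t+u]²-[t-u]² : (t + u) * (t + u) - (t - u) * (t - u) ≡ (2# * 2#) * (t * u)
            [t+u]²-[t-u]² = solve 2 (λ t u → (t :+ u) :* (t :+ u) :- (t :- u) :* (t :- u) := (κ 2 :* κ 2) :* (t :* u)) refl t u
            4tu≢0 : (2# * 2#) * (t * u) ≢ 0#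
            4tu≢0 = *≢0 (*≢0 2≢0 2≢0) (*≢0 t≢0 (*≢0 2≢0 w≢0))
        E1 : Edge (t + u , t - u) (t , x - r)
        E1 = agm-edge vQ (sym [t+u][t-u]≡[x-r]²) (solve 2 (λ t u → κ 2 :* t := (t :+ u) :+ (t :- u)) refl t u)
        E2 : Edge (t + u , t - u) (t , r - x)
        E2 = agm-edge vQ (trans (solve 2 (λ x r → (r :- x) :* (r :- x) := (x :- r) :* (x :- r)) refl x r) (sym [t+u][t-u]≡[x-r]²))
                         (solve 2 (λ t u → κ 2 :* t := (t :+ u) :+ (t :- u)) refl t u)
        E3 : Edge (t , x - r) (x , y)
        E3 = agm-edge (proj₁ (proj₂ E1)) (trans (sym [x-r]t≡y²) (*-comm (x - r) t))
                      (solve 2 (λ x r → κ 2 :* x := (x :+ r) :+ (x :- r)) refl x r)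
        E4 : Edge (t , r - x) (r , j)
        E4 = agm-edge (proj₁ (proj₂ E2)) (begin
                j * j                ≡⟨ j²≡-y² ⟩
                - (y * y)            ≡⟨ cong -_ [x-r]t≡y² ⟨
                - ((x - r) * t)      ≡⟨ solve 2 (λ x r → :- ((x :- r) :* (x :+ r)) := (x :+ r) :* (r :- x)) refl x r ⟩
                t * (r - x)          ∎)
              (solve 2 (λ x r → κ 2 :* r := (x :+ r) :+ (r :- x)) refl x r)

  IsLambda-via : ∀ {c d C D l} → c * c ≡ C → d * d ≡ D → C * l ≡ D → IsLambda (c , d) l
  IsLambda-via {l = l} c²≡C d²≡D Cl≡D = trans (cong (_* l) c²≡C) (trans Cl≡D (sym d²≡D))

  module _ {A B l l′ : Carrier} (Al≡B : A * l ≡ B) where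

    Λ-1/λ : l * l′ ≡ 1# → B * l′ ≡ A
    Λ-1/λ ll′≡1 = begin
      B * l′          ≡⟨ cong (_* l′) Al≡B ⟨
      (A * l) * l′    ≡⟨ *-assoc A l l′ ⟩
      A * (l * l′)    ≡⟨ cong (A *_) ll′≡1 ⟩
      A * 1#          ≡⟨ *-identityʳ A ⟩
      A               ∎

    Λ-1-λ : l′ ≡ 1# - l → - A * l′ ≡ B - A
    Λ-1-λ l′≡1-l = begin
      - A * l′         ≡⟨ cong (- A *_) l′≡1-l ⟩
      - A * (1# - l)   ≡⟨ solve 2 (λ A l → :- A :* (κ 1 :- l) := A :* l :- A) refl A l ⟩
      A * l - A        ≡⟨ cong (_- A) Al≡B ⟩
      B - A            ∎

    Λ-1/[1-λ] : (1# - l) * l′ ≡ 1# → (B - A) * l′ ≡ - A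
    Λ-1/[1-λ] [1-l]l′≡1 = begin
      (B - A) * l′           ≡⟨ cong (λ b → (b - A) * l′) Al≡B ⟨
      (A * l - A) * l′       ≡⟨ solve 3 (λ A l l′ → (A :* l :- A) :* l′ := :- A :* ((κ 1 :- l) :* l′)) refl A l l′ ⟩
      - A * ((1# - l) * l′)  ≡⟨ cong (- A *_) [1-l]l′≡1 ⟩
      - A * 1#               ≡⟨ *-identityʳ (- A) ⟩
      - A                    ∎

    Λ-λ/[λ-1] : (l - 1#) * l′ ≡ l → (A - B) * l′ ≡ - B
    Λ-λ/[λ-1] [l-1]l′≡l = begin
      (A - B) * l′           ≡⟨ cong (λ b → (A - b) * l′) Al≡B ⟨
      (A - A * l) * l′       ≡⟨ solve 3 (λ A l l′ → (A :- A :* l) :* l′ := :- A :* ((l :- κ 1) :* l′)) refl A l l′ ⟩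
      - A * ((l - 1#) * l′)  ≡⟨ cong (- A *_) [l-1]l′≡l ⟩
      - A * l                ≡⟨ solve 2 (λ A l → :- A :* l := :- (A :* l)) refl A l ⟩
      - (A * l)              ≡⟨ cong -_ Al≡B ⟩
      - B                    ∎

    Λ-[λ-1]/λ : l * l′ ≡ l - 1# → - B * l′ ≡ A - B
    Λ-[λ-1]/λ ll′≡l-1 = begin
      - B * l′               ≡⟨ cong (λ b → - b * l′) Al≡B ⟨
      - (A * l) * l′         ≡⟨ solve 3 (λ A l l′ → :- (A :* l) :* l′ := :- A :* (l :* l′)) refl A l l′ ⟩
      - A * (l * l′)         ≡⟨ cong (- A *_) ll′≡l-1 ⟩
      - A * (l - 1#)         ≡⟨ solve 2 (λ A l → :- A :* (l :- κ 1) := A :- A :* l) refl A l ⟩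
      A - A * l              ≡⟨ cong (λ b → A - b) Al≡B ⟩
      A - B                  ∎

module FiniteFieldTheory {N} (K : FiniteField N) where

  open FiniteField K
  open FieldNotions field′
  open FieldTheory field′
  open Inverse enumeration using (from; to; strictlyInverseˡ; strictlyInverseʳ)
  open ≡-Reasoning

  infix 4 _≟_
  _≟_ : DecidableEquality Carrier
  _≟_ = Fin.inj⇒≟ (↔⇒↣ enumeration)

  open Removal _≟_
  open Products _≟_

  ^ᶠ≡0⇒≡0 : ∀ {x} n → x ^ᶠ n ≡ 0# → x ≡ 0#
  ^ᶠ≡0⇒≡0 {x} n xⁿ≡0 with x ≟ 0#
  ... | yes x≡0 = x≡0
  ... | no x≢0 = contradiction xⁿ≡0 (^ᶠ≢0 n x≢0)

  elements : List Carrier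
  elements = map from (allFin N)

  ∈-elements : ∀ x → x ∈ elements
  ∈-elements x = subst (_∈ elements) (strictlyInverseʳ x) (∈.∈-map⁺ from (∈.∈-allFin (to x)))

  elements! : Unique elements
  elements! = Unique.map⁺ (λ {i} {j} eq → trans (sym (strictlyInverseˡ i)) (trans (cong to eq) (strictlyInverseˡ j)))
                          (Unique.allFin⁺ N)

  length-elements : length elements ≡ N
  length-elements = trans (length-map from (allFin N)) (length-tabulate (λ i → i))

  sum : List Carrier → Carrier
  sum = foldr _+_ 0#

  sum-map-+1 : ∀ xs → sum (map (_+ 1#) xs) ≡ sum xs + ι (length xs)
  sum-map-+1 [] = sym (+-identityʳ 0#)
  sum-map-+1 (x ∷ xs) = begin
    (x + 1#) + sum (map (_+ 1#) xs)        ≡⟨ cong ((x + 1#) +_) (sum-map-+1 xs) ⟩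
    (x + 1#) + (sum xs + ι (length xs))    ≡⟨ solve 4 (λ x o s n → (x :+ o) :+ (s :+ n) := (x :+ s) :+ (o :+ n)) refl x 1# _ _ ⟩
    (x + sum xs) + (1# + ι (length xs))    ≡⟨ cong ((x + sum xs) +_) (ι-+ 1 (length xs)) ⟨
    (x + sum xs) + ι (suc (length xs))     ∎

  -- translation by 1 permutes the field, so adding 1 to every element adds N to the sum
  ι[N]≡0 : ι N ≡ 0#
  ι[N]≡0 = begin
    ι N                                   ≡⟨ solve 2 (λ s n → n := (s :+ n) :- s) refl S (ι N) ⟩
    (S + ι N) - S                         ≡⟨ cong (λ n → (S + ι n) - S) length-elements ⟨
    (S + ι (length elements)) - S         ≡⟨ cong (_- S) (sum-map-+1 elements) ⟨
    sum (map (_+ 1#) elements) - S        ≡⟨ cong (_- S) (foldr-commMonoid (≡.setoid Carrier) +-isCommutativeMonoid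
                                                                          (↭⇒↭ₛ shift↭)) ⟩
    S - S                                 ≡⟨ -‿inverseʳ S ⟩
    0#                                    ∎
    where
      S = sum elements
      shift↭ : map (_+ 1#) elements ↭ elements
      shift↭ = unique∧set⇒↭ (Unique.map⁺ +1-injective elements!) elements!
        (mk⇔ (λ _ → ∈-elements _) (λ _ → ∈-shifted _))
        where
          ∈-shifted : ∀ y → y ∈ map (_+ 1#) elements
          ∈-shifted y = subst (_∈ map (_+ 1#) elements) (solve 2 (λ y o → (y :- o) :+ o := y) refl y 1#)
                              (∈.∈-map⁺ (_+ 1#) (∈-elements (y - 1#)))
          +1-injective : ∀ {x y} → x + 1# ≡ y + 1# → x ≡ y
          +1-injective {x} {y} eq = begin
            x                ≡⟨ solve 2 (λ x o → x := (x :+ o) :- o) refl x 1# ⟩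
            (x + 1#) - 1#    ≡⟨ cong (_- 1#) eq ⟩
            (y + 1#) - 1#    ≡⟨ solve 2 (λ y o → (y :+ o) :- o := y) refl y 1# ⟩
            y                ∎

  nonzero : List Carrier
  nonzero = elements ∖ 0#

  ∈-nonzero : ∀ {x} → x ≢ 0# → x ∈ nonzero
  ∈-nonzero {x} = ∈-∖⁺ (∈-elements x)

  nonzero⇒≢0 : ∀ {x} → x ∈ nonzero → x ≢ 0#
  nonzero⇒≢0 x∈ = proj₂ (∈-∖⁻ elements x∈)

  nonzero! : Unique nonzero
  nonzero! = ∖-unique 0# elements!

  length-nonzero : N ≡ suc (length nonzero)
  length-nonzero = trans (sym length-elements) (↭-length (↭-∖ elements! (∈-elements 0#)))

  quotient : ∀ {t} c → t ≢ 0# → ∃ λ y → t * y ≡ c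
  quotient {t} c t≢0 = c * t⁻¹ , (begin
    t * (c * t⁻¹)    ≡⟨ solve 3 (λ t c u → t :* (c :* u) := c :* (t :* u)) refl t c t⁻¹ ⟩
    c * (t * t⁻¹)    ≡⟨ cong (c *_) (proj₂ (inverse t t≢0)) ⟩
    c * 1#           ≡⟨ *-identityʳ c ⟩
    c                ∎)
    where t⁻¹ = proj₁ (inverse t t≢0)

  module OddOrder (m : ℕ) (N≡1+2m : N ≡ suc (2 ℕ.* m)) where

    2≢0 : 2# ≢ 0#
    2≢0 2≡0 = 0≢1 (sym (begin
      1#                  ≡⟨ +-identityʳ 1# ⟨
      1# + 0#             ≡⟨ cong (1# +_) (zeroˡ (ι m)) ⟨
      1# + 0# * ι m       ≡⟨ cong (λ t → 1# + t * ι m) 2≡0 ⟨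
      1# + 2# * ι m       ≡⟨ trans (ι-+ 1 (2 ℕ.* m)) (cong (1# +_) (ι-* 2 m)) ⟨
      ι (suc (2 ℕ.* m))   ≡⟨ cong ι N≡1+2m ⟨
      ι N                 ≡⟨ ι[N]≡0 ⟩
      0#                  ∎))

    length-nonzero≡2m : length nonzero ≡ 2 ℕ.* m
    length-nonzero≡2m = ℕ.suc-injective (trans (sym length-nonzero) N≡1+2m)

    -1≢1 : - 1# ≢ 1#
    -1≢1 -1≡1 = 2≢0 (trans (cong (1# +_) (sym -1≡1)) (-‿inverseʳ 1#))

    wilson : product nonzero ≡ - 1#
    wilson = begin
      product nonzero             ≡⟨ product-↭ nonzero↭ ⟩
      1# * (- 1# * product rest)  ≡⟨ cong (λ p → 1# * (- 1# * p))
                                        (trans (product-paired 1≢0 m′ rest rest! rest-length partner no-fix) (1^ᶠ m′)) ⟩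
      1# * (- 1# * 1#)            ≡⟨ trans (*-identityˡ _) (*-identityʳ _) ⟩
      - 1#                        ∎
      where
        rest = nonzero ∖ 1# ∖ - 1#
        nonzero↭ : nonzero ↭ 1# ∷ - 1# ∷ rest
        nonzero↭ = ↭-∖∖ nonzero! (∈-nonzero 1≢0) (∈-nonzero (-≢0 1≢0)) -1≢1
        rest! : Unique rest
        rest! = ∖-unique (- 1#) (∖-unique 1# nonzero!)
        half-length : ∀ {n} m → suc (suc n) ≡ 2 ℕ.* m → ∃ λ m′ → n ≡ 2 ℕ.* m′
        half-length (suc m′) eq = m′ , ℕ.suc-injective (ℕ.suc-injective (trans eq (ℕ.*-suc 2 m′)))
        halves = half-length m (trans (sym (↭-length nonzero↭)) length-nonzero≡2m)
        m′ = proj₁ halves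
        rest-length = proj₂ halves
        partner : ∀ {t} → t ∈ rest → ∃ λ u → u ∈ rest × t * u ≡ 1#
        partner {t} t∈rest with ∈-∖∖⁻ nonzero t∈rest
        ... | t∈nonzero , t≢1 , t≢-1 with quotient 1# (nonzero⇒≢0 t∈nonzero)
        ...   | u , tu≡1 = u , ∈-∖⁺ (∈-∖⁺ (∈-nonzero u≢0) u≢1) u≢-1 , tu≡1
          where
            u≢0 : u ≢ 0#
            u≢0 = *≢0⇒ʳ (λ tu≡0 → 1≢0 (trans (sym tu≡1) tu≡0))
            u≢1 : u ≢ 1#
            u≢1 u≡1 = t≢1 (trans (sym (*-identityʳ t)) (trans (cong (t *_) (sym u≡1)) tu≡1))
            u≢-1 : u ≢ - 1#
            u≢-1 u≡-1 = t≢-1 (begin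
              t                  ≡⟨ solve 1 (λ t → t := :- (t :* :- κ 1)) refl t ⟩
              - (t * - 1#)       ≡⟨ cong (λ v → - (t * v)) u≡-1 ⟨
              - (t * u)          ≡⟨ cong -_ tu≡1 ⟩
              - 1#               ∎)
        no-fix : ∀ {t} → t ∈ rest → t * t ≢ 1#
        no-fix t∈rest t²≡1 with ∈-∖∖⁻ nonzero t∈rest
        ... | _ , t≢1 , t≢-1 = squares≢ t≢1 t≢-1 (trans t²≡1 (sym (*-identityˡ 1#)))

    product-nonzero-nonsquare : ∀ {z} → z ≢ 0# → (∀ y → y * y ≢ z) → product nonzero ≡ z ^ᶠ m
    product-nonzero-nonsquare {z} z≢0 nonsquare =
      product-paired z≢0 m nonzero nonzero! length-nonzero≡2m partner (λ {t} _ → nonsquare t)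
      where
        partner : ∀ {t} → t ∈ nonzero → ∃ λ u → u ∈ nonzero × t * u ≡ z
        partner t∈nonzero with quotient z (nonzero⇒≢0 t∈nonzero)
        ... | u , tu≡z = u , ∈-nonzero (*≢0⇒ʳ (λ tu≡0 → z≢0 (trans (sym tu≡z) tu≡0))) , tu≡z

    -- by Wilson's theorem a non-square z would give -1 = product nonzero = z ^ m
    euler : ∀ {z} → z ≢ 0# → z ^ᶠ m ≡ 1# → ∃ λ y → y * y ≡ z
    euler {z} z≢0 zᵐ≡1 with any? (λ y → y * y ≟ z) elements
    ... | yes square = satisfied square
    ... | no ¬square = contradiction (trans (sym wilson) (trans (product-nonzero-nonsquare z≢0 nonsquare) zᵐ≡1)) -1≢1
      where
        nonsquare : ∀ y → y * y ≢ z
        nonsquare y y²≡z = ¬square (lose (∈-elements y) y²≡z)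

  InSubfield⇒square : ∀ {g z} → N ≡ suc (2 ℕ.* g) ^ 2 → z ≢ 0# → InSubfield (suc (2 ℕ.* g)) z →
                      ∃ λ y → y * y ≡ z
  InSubfield⇒square {g} N≡n² z≢0 z∈ =
    OddOrder.euler (2 ℕ.* g ℕ.* suc g) (trans N≡n² (odd-square g)) z≢0 (InSubfield⇒^half≡1 g z≢0 z∈)

module QuarticExtension {p} (k : ℕ) {q} (p-prime : Prime p) (p≢2 : p ≢ 2) (q≡p^k : q ≡ p ^ k)
                        (K : FiniteField (q ^ 4)) where

  open FiniteField K
  open FieldNotions field′
  open FieldTheory field′
  open FiniteFieldTheory K

  q-odd : Odd q
  q-odd = subst Odd (sym q≡p^k) (odd-^ (prime⇒odd p-prime p≢2) k)

  g : ℕ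
  g = proj₁ q-odd

  q≡1+2g : q ≡ suc (2 ℕ.* g)
  q≡1+2g = proj₂ q-odd

  G : ℕ
  G = 2 ℕ.* g ℕ.* suc g

  q²≡1+2G : q ^ 2 ≡ suc (2 ℕ.* G)
  q²≡1+2G = trans (cong (_^ 2) q≡1+2g) (odd-square g)

  q⁴≡[q²]² : q ^ 4 ≡ suc (2 ℕ.* G) ^ 2
  q⁴≡[q²]² = trans (^4≡^2^2 q) (cong (_^ 2) q²≡1+2G)

  open OddOrder (2 ℕ.* G ℕ.* suc G) (trans q⁴≡[q²]² (odd-square G)) using (2≢0)
  open Aquarium 2≢0

  char-p : ι p ≡ 0#
  char-p = ^ᶠ≡0⇒≡0 k (trans (sym (ι-^ p k)) (subst (λ n → ι n ≡ 0#) q≡p^k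
             (^ᶠ≡0⇒≡0 4 (trans (sym (ι-^ q 4)) ι[N]≡0))))

  via : ∀ {m n x} → m ≡ n → InSubfield m x → InSubfield n x
  via {x = x} m≡n = subst (λ n → InSubfield n x) m≡n

  Fq-+ : ∀ {x y} → InSubfield q x → InSubfield q y → InSubfield q (x + y)
  Fq-+ x∈ y∈ = via (sym q≡p^k) (InSubfield-+ p-prime char-p k (via q≡p^k x∈) (via q≡p^k y∈))

  Fq-neg : ∀ {x} → InSubfield q x → InSubfield q (- x)
  Fq-neg x∈ = via (sym q≡1+2g) (InSubfield-neg g (via q≡1+2g x∈))

  Fq⊆Fq² : ∀ {x} → InSubfield q x → InSubfield (q ^ 2) x
  Fq⊆Fq² x∈ = InSubfield-^ q x∈ 2

  Fq²-square : ∀ {z} → InSubfield (q ^ 2) z → z ≢ 0# → ∃ λ y → y * y ≡ z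
  Fq²-square z∈ z≢0 = InSubfield⇒square {G} q⁴≡[q²]² z≢0 (via q²≡1+2G z∈)

  Fq-√ : ∀ {z} → InSubfield q z → z ≢ 0# → ∃ λ y → y * y ≡ z × InSubfield (q ^ 2) y
  Fq-√ z∈ z≢0 with Fq²-square (Fq⊆Fq² z∈) z≢0
  ... | y , y²≡z = y , y²≡z , via (cong (_^ 2) (sym q≡1+2g)) (InSubfield-√ g z≢0 (via q≡1+2g z∈) y²≡z)

  swap : ∀ {x y} → InV (x , y) → InSubfield (q ^ 2) x → InSubfield (q ^ 2) y → SameComponent (x , y) (y , x)
  swap v x∈ y∈ = SameComponent-swap v (proj₂ (Fq²-square (InSubfield-* (q ^ 2) x∈ y∈) (InV⇒*≢0 v)))

  record RootPair (x y : Carrier) : Set where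
    field
      r j       : Carrier
      r∈        : InSubfield (q ^ 2) r
      j∈        : InSubfield (q ^ 2) j
      r²        : r * r ≡ x * x - y * y
      j²        : j * j ≡ - (y * y)
      valid     : InV (r , j)
      connected : SameComponent (x , y) (r , j)

  root-pair : ∀ {x y} → InV (x , y) → InSubfield q x → InSubfield q y → RootPair x y
  root-pair {x} {y} v@(x≢0 , y≢0 , x≢y , x≢-y) x∈ y∈ = record
    { r = r ; j = j ; r∈ = proj₂ (proj₂ R) ; j∈ = proj₂ (proj₂ J) ; r² = r² ; j² = j²
    ; valid = proj₁ (SameComponent-root-pair v r² w² j²)
    ; connected = proj₂ (SameComponent-root-pair v r² w² j²) }
    where
      x²-y²≢0 : x * x - y * y ≢ 0#
      x²-y²≢0 = ≢⇒-≢0 (squares≢ x≢y x≢-y)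
      R = Fq-√ (Fq-+ (InSubfield-* q x∈ x∈) (Fq-neg (InSubfield-* q y∈ y∈))) x²-y²≢0
      J = Fq-√ (Fq-neg (InSubfield-* q y∈ y∈)) (-≢0 (square≢0 y≢0))
      r = proj₁ R
      r² = proj₁ (proj₂ R)
      j = proj₁ J
      j² = proj₁ (proj₂ J)
      W = Fq²-square (InSubfield-* (q ^ 2) (Fq⊆Fq² x∈) (proj₂ (proj₂ R))) (*≢0 x≢0 (root≢0 r² x²-y²≢0))
      w² = proj₂ W

  Λ-orbit-connected : (a b : Carrier) → InVSub q (a , b) → (l : Carrier) → IsLambda (a , b) l →
    (l′ : Carrier) → InΛ l l′ →
    Σ Carrier λ c → Σ Carrier λ d → InVSub (q ^ 2) (c , d) × IsLambda (c , d) l′ × SameComponent (a , b) (c , d)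
  Λ-orbit-connected a b (v , a∈ , b∈) l Al≡B l′ (inj₁ l′≡l) =
    a , b , (v , Fq⊆Fq² a∈ , Fq⊆Fq² b∈) , subst (IsLambda (a , b)) (sym l′≡l) Al≡B , ε
  Λ-orbit-connected a b (v , a∈ , b∈) l Al≡B l′ (inj₂ (inj₁ ll′≡1)) =
    b , a , (InV-sym v , Fq⊆Fq² b∈ , Fq⊆Fq² a∈) , Λ-1/λ Al≡B ll′≡1 , swap v (Fq⊆Fq² a∈) (Fq⊆Fq² b∈)
  Λ-orbit-connected a b (v , a∈ , b∈) l Al≡B l′ (inj₂ (inj₂ (inj₁ l′≡1-l))) =
    j , r , (InV-sym valid , j∈ , r∈) , IsLambda-via j² r² (Λ-1-λ Al≡B l′≡1-l) ,
    swap v (Fq⊆Fq² a∈) (Fq⊆Fq² b∈) ◅◅ connected ◅◅ swap valid r∈ j∈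
    where open RootPair (root-pair (InV-sym v) b∈ a∈)
  Λ-orbit-connected a b (v , a∈ , b∈) l Al≡B l′ (inj₂ (inj₂ (inj₂ (inj₁ [1-l]l′≡1)))) =
    r , j , (valid , r∈ , j∈) , IsLambda-via r² j² (Λ-1/[1-λ] Al≡B [1-l]l′≡1) ,
    swap v (Fq⊆Fq² a∈) (Fq⊆Fq² b∈) ◅◅ connected
    where open RootPair (root-pair (InV-sym v) b∈ a∈)
  Λ-orbit-connected a b (v , a∈ , b∈) l Al≡B l′ (inj₂ (inj₂ (inj₂ (inj₂ (inj₁ [l-1]l′≡l))))) =
    r , j , (valid , r∈ , j∈) , IsLambda-via r² j² (Λ-λ/[λ-1] Al≡B [l-1]l′≡l) , connected
    where open RootPair (root-pair v a∈ b∈)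
  Λ-orbit-connected a b (v , a∈ , b∈) l Al≡B l′ (inj₂ (inj₂ (inj₂ (inj₂ (inj₂ ll′≡l-1))))) =
    j , r , (InV-sym valid , j∈ , r∈) , IsLambda-via j² r² (Λ-[λ-1]/λ Al≡B ll′≡l-1) ,
    connected ◅◅ swap valid r∈ j∈
    where open RootPair (root-pair v a∈ b∈)

lemma3p4 : (q : ℕ) → OddPrimePower q → (K : FiniteField (q ^ 4)) →
    let open FiniteField K in
    let open FieldNotions field′ in
    (a b : Carrier) → InVSub q (a , b) →
    (l : Carrier) → IsLambda (a , b) l →
    (l′ : Carrier) → InΛ l l′ →
    Σ Carrier λ c → Σ Carrier λ d →
      InVSub (q ^ 2) (c , d) × IsLambda (c , d) l′ × SameComponent (a , b) (c , d)
lemma3p4 q (p , k , p-prime , p≢2 , _ , q≡p^k) K = QuarticExtension.Λ-orbit-connected k p-prime p≢2 q≡p^k K
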